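{- Let $q$ be a prime power and $h,N,K$ positive integers. An $[N,K]_{q^h}$ code $\mathcal{C}$ is outer minimal if and only if all its nonzero codewords are outer minimal.
   Context: For $c\in\mathbb{F}_{q^h}^N$, $\sigma(c)=\{i:c_i\neq0\}$. A nonzero codeword $c\in\mathcal{C}$ is outer minimal if for every $c'\in\mathcal{C}$: whenever $\sigma(c')\subseteq\sigma(c)$ and for every $i\in\sigma(c)$ there exists $\lambda_i\in\mathbb{F}_q$ with $c'_i=\lambda_ic_i$, there exists $\lambda\in\mathbb{F}_q$ with $c'=\lambda c$. The code $\mathcal{C}$ is outer minimal if the concatenated code $\{(\pi(c_1),\dots,\pi(c_N)):c\in\mathcal{C}\}$ over $\mathbb{F}_q$ is minimal, where $\pi:\mathbb{F}_{q^h}\to\mathbb{F}_q^{(q^h-1)/(q-1)}$ is an injective $\mathbb{F}_q$-linear map whose image is the simplex code $\mathcal{S}_q(h)$ (generated by a matrix whose columns are one nonzero representative of each $1$-dimensional subspace of $\mathbb{F}_q^h$); here a linear code is minimal if for any two nonzero codewords $v,v'$ with $\sigma(v')\subseteq\sigma(v)$, $v'$ is a scalar multiple of $v$. -}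

module Defs where

open import Level using (Level; _⊔_) renaming (suc to lsuc)
open import Data.Nat using (ℕ; _^_)

open import Data.Nat.Primality using (Prime)
open import Data.Fin using (Fin)
open import Data.Product using (Σ; ∃; ∃-syntax; _×_; _,_)
open import Relation.Binary.PropositionalEquality using (_≡_)
open import Relation.Nullary using (¬_)
open import Function.Bundles using (_⇔_)
open import Algebra.Bundles using (CommutativeRing)
open import Algebra.Morphism.Structures using (IsRingHomomorphism)

IsPrimePower : ℕ → Set
IsPrimePower q = Σ ℕ λ p → Σ ℕ λ k → Prime p × q ≡ p ^ ℕ.suc k

module _ {c ℓ : Level} (R : CommutativeRing c ℓ) where
  open CommutativeRing R using (Carrier; _≈_; _+_; _*_; 0#; 1#)

  ∑ : {n : ℕ} → (Fin n → Carrier) → Carrier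
  ∑ {ℕ.zero} f = 0#
  ∑ {ℕ.suc n} f = f Fin.zero + ∑ (λ i → f (Fin.suc i))

  IsField : Set (c ⊔ ℓ)
  IsField = (¬ (1# ≈ 0#)) × (∀ x → ¬ (x ≈ 0#) → ∃[ y ] (x * y ≈ 1#))

  HasCardinality : ℕ → Set (c ⊔ ℓ)
  HasCardinality q = Σ (Fin q → Carrier) λ e →
    (∀ i j → e i ≈ e j → i ≡ j) × (∀ x → ∃[ i ] (e i ≈ x))

  _∈σ_ : {I : Set} → I → (I → Carrier) → Set ℓ
  i ∈σ v = ¬ (v i ≈ 0#)

  _⊆σ_ : {I : Set} → (I → Carrier) → (I → Carrier) → Set ℓ
  v' ⊆σ v = ∀ i → i ∈σ v' → i ∈σ v

  NonZeroVec : {I : Set} → (I → Carrier) → Set ℓ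
  NonZeroVec v = ¬ (∀ i → v i ≈ 0#)

  IsMinimalCode : {I : Set} {p : Level} → ((I → Carrier) → Set p) → Set (c ⊔ ℓ ⊔ p)
  IsMinimalCode {I} D = ∀ (v v' : I → Carrier) → D v → D v' →
    NonZeroVec v → NonZeroVec v' → v' ⊆σ v → ∃[ λ' ] (∀ i → v' i ≈ λ' * v i)

  IsLinearCode : (N K : ℕ) {p : Level} → ((Fin N → Carrier) → Set p) → Set (c ⊔ ℓ ⊔ p)
  IsLinearCode N K C = Σ (Fin K → Fin N → Carrier) λ G →
    (∀ (a : Fin K → Carrier) → (∀ j → ∑ (λ k → a k * G k j) ≈ 0#) → ∀ k → a k ≈ 0#)
    × (∀ (x : Fin N → Carrier) → C x ⇔ (Σ (Fin K → Carrier) λ a → (∀ j → x j ≈ ∑ (λ k → a k * G k j))))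

module _ {c ℓ c' ℓ' : Level} (F : CommutativeRing c ℓ) (L : CommutativeRing c' ℓ')
         (ι : CommutativeRing.Carrier F → CommutativeRing.Carrier L) where
  private
    module F = CommutativeRing F
    module L = CommutativeRing L

  _•_ : F.Carrier → L.Carrier → L.Carrier
  a • x = ι a L.* x

  IsExtensionOfDegree : ℕ → Set (c ⊔ ℓ ⊔ c' ⊔ ℓ')
  IsExtensionOfDegree h =
    IsRingHomomorphism F.rawRing L.rawRing ι ×
    Σ (Fin h → L.Carrier) λ b →
      (∀ x → Σ (Fin h → F.Carrier) λ a → (x L.≈ ∑ L (λ i → a i • b i)))
      × (∀ (a : Fin h → F.Carrier) → ∑ L (λ i → a i • b i) L.≈ L.0# → ∀ i → a i F.≈ F.0#)

  -- G : Fin h → Fin M → F is a generator matrix of the simplex code S_q(h):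
  -- its columns are nonzero and contain exactly one representative of each
  -- 1-dimensional subspace of F^h
  IsSimplexGenerator : (h M : ℕ) → (Fin h → Fin M → F.Carrier) → Set (c ⊔ ℓ)
  IsSimplexGenerator h M G =
    (∀ j → NonZeroVec F (λ i → G i j))
    × (∀ (w : Fin h → F.Carrier) → NonZeroVec F w →
         ∃[ j ] ∃[ μ ] (∀ i → w i F.≈ μ F.* G i j))
    × (∀ j j' → ∃[ μ ] ∃[ μ' ] (∀ i → G i j F.≈ μ F.* G i j') × (∀ i → G i j' F.≈ μ' F.* G i j) → j ≡ j')

  IsSimplexEmbedding : (h M : ℕ) → (Fin h → Fin M → F.Carrier) →
                       (L.Carrier → Fin M → F.Carrier) → Set (c ⊔ ℓ ⊔ c' ⊔ ℓ')
  IsSimplexEmbedding h M G π =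
    (∀ x y → x L.≈ y → ∀ j → π x j F.≈ π y j)
    × (∀ x y j → π (x L.+ y) j F.≈ π x j F.+ π y j)
    × (∀ a x j → π (a • x) j F.≈ a F.* π x j)
    × (∀ x y → (∀ j → π x j F.≈ π y j) → x L.≈ y)
    × (∀ (v : Fin M → F.Carrier) →
         (Σ L.Carrier λ x → (∀ j → π x j F.≈ v j)) ⇔ (Σ (Fin h → F.Carrier) λ u → (∀ j → v j F.≈ ∑ F (λ i → u i F.* G i j))))

  Concat : {N M : ℕ} {p : Level} → (L.Carrier → Fin M → F.Carrier) →
           ((Fin N → L.Carrier) → Set p) → ((Fin N × Fin M) → F.Carrier) → Set (c' ⊔ ℓ ⊔ p)
  Concat {N} π C v = ∃[ x ] (C x × (∀ i j → v (i , j) F.≈ π (x i) j))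

  IsOuterMinimalCode : {N M : ℕ} {p : Level} → (L.Carrier → Fin M → F.Carrier) →
                       ((Fin N → L.Carrier) → Set p) → Set (c ⊔ ℓ ⊔ c' ⊔ p)
  IsOuterMinimalCode π C = IsMinimalCode F (Concat π C)

  IsOuterMinimalWord : {N : ℕ} {p : Level} → ((Fin N → L.Carrier) → Set p) →
                       (Fin N → L.Carrier) → Set (c ⊔ ℓ' ⊔ c' ⊔ p)
  IsOuterMinimalWord {N} C x = ∀ (x' : Fin N → L.Carrier) → C x' →
    _⊆σ_ L x' x →
    (∀ i → _∈σ_ L i x → ∃[ λi ] (x' i L.≈ λi • x i)) →
    ∃[ λ' ] (∀ i → x' i L.≈ λ' • x i)

-- The simplex code determines its codewords up to 𝔽_q-scalars by their supports.
-- Write π(x) = u·G and π(y) = u'·G. Every nonzero w ∈ 𝔽_q^h is a multiple of a column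
-- of G, so if σ(π y) ⊆ σ(π x) then every w annihilating u annihilates u', whence
-- u' = μ u and y = μ x. Thus for concatenated codewords σ(π c') ⊆ σ(π c) holds exactly
-- when σ(c') ⊆ σ(c) and every c'_i lies in 𝔽_q c_i, while π c' = λ π c iff c' = λ c
-- by injectivity and 𝔽_q-linearity of π.
module Submission where

open import Defs
open import Level using (Level)
open import Data.Nat using (ℕ; _<_)
open import Data.Fin using (Fin; zero; suc) renaming (_≟_ to _≟ᶠ_)
open import Data.Fin.Properties using (¬∀⟶∃¬; all?)
open import Data.Product using (∃-syntax; _×_; _,_; proj₁; proj₂; map₂)
open import Function.Base using (_∘_)
open import Function.Bundles using (_⇔_; mk⇔; Equivalence)
open import Relation.Binary.PropositionalEquality as ≡ using (_≡_)
open import Relation.Nullary using (¬_; Dec; yes; no)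
open import Relation.Nullary.Decidable using (decidable-stable)
open import Algebra.Bundles using (CommutativeRing)

module _ {c ℓ} (F : CommutativeRing c ℓ) where
  open CommutativeRing F
  open import Relation.Binary.Reasoning.Setoid setoid

  HasCardinality⇒≈-dec : ∀ {q} → HasCardinality F q → ∀ x y → Dec (x ≈ y)
  HasCardinality⇒≈-dec (e , e-injective , e-surjective) x y
    with e-surjective x | e-surjective y
  ... | i , eᵢ≈x | j , eⱼ≈y with i ≟ᶠ j
  ...   | yes ≡.refl = yes (trans (sym eᵢ≈x) eⱼ≈y)
  ...   | no  i≢j    = no λ x≈y → i≢j (e-injective i j (trans eᵢ≈x (trans x≈y (sym eⱼ≈y))))

  IsField⇒x*y≈0⇒y≈0 : IsField F → ∀ {x y} → ¬ (x ≈ 0#) → x * y ≈ 0# → y ≈ 0#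
  IsField⇒x*y≈0⇒y≈0 (_ , inverse) {x} {y} x≉0 xy≈0 with inverse x x≉0
  ... | x⁻¹ , x*x⁻¹≈1 = begin
    y             ≈⟨ *-identityˡ y ⟨
    1# * y        ≈⟨ *-congʳ (trans (*-comm x⁻¹ x) x*x⁻¹≈1) ⟨
    (x⁻¹ * x) * y ≈⟨ *-assoc x⁻¹ x y ⟩
    x⁻¹ * (x * y) ≈⟨ *-congˡ xy≈0 ⟩
    x⁻¹ * 0#      ≈⟨ zeroʳ x⁻¹ ⟩
    0#            ∎

module DotProduct {c ℓ} (F : CommutativeRing c ℓ) where
  open CommutativeRing F hiding (zero)
  open import Algebra.Properties.Semiring.Sum semiring
    using (sum; sum-cong-≋; sum-replicate-zero; ∑-distrib-+; *-distribˡ-sum)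
  open import Algebra.Properties.CommutativeSemigroup *-commutativeSemigroup
    using (x∙yz≈y∙xz)
  open import Relation.Binary.Reasoning.Setoid setoid

  ∑≡sum : ∀ {n} (f : Fin n → Carrier) → ∑ F f ≡ sum f
  ∑≡sum {ℕ.zero}  f = ≡.refl
  ∑≡sum {ℕ.suc n} f = ≡.cong (f zero +_) (∑≡sum (f ∘ suc))

  infix 7 _·_
  _·_ : ∀ {n} → (Fin n → Carrier) → (Fin n → Carrier) → Carrier
  u · v = sum (λ i → u i * v i)

  ·-congˡ : ∀ {n} {u u' : Fin n → Carrier} v → (∀ i → u i ≈ u' i) → u · v ≈ u' · v
  ·-congˡ v u≈u' = sum-cong-≋ (λ i → *-congʳ (u≈u' i))

  ·-congʳ : ∀ {n} u {v v' : Fin n → Carrier} → (∀ i → v i ≈ v' i) → u · v ≈ u · v'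
  ·-congʳ u v≈v' = sum-cong-≋ (λ i → *-congˡ (v≈v' i))

  column : ∀ {m n} → (Fin m → Fin n → Carrier) → Fin n → Fin m → Carrier
  column G j i = G i j

  ·-zeroˡ : ∀ {n} (u v : Fin n → Carrier) → (∀ i → u i ≈ 0#) → u · v ≈ 0#
  ·-zeroˡ {n} u v u≈0 =
    trans (sum-cong-≋ (λ i → trans (*-congʳ (u≈0 i)) (zeroˡ (v i)))) (sum-replicate-zero n)

  ·-zeroʳ : ∀ {n} u (v : Fin n → Carrier) → (∀ i → v i ≈ 0#) → u · v ≈ 0#
  ·-zeroʳ {n} u v v≈0 =
    trans (sum-cong-≋ (λ i → trans (*-congˡ (v≈0 i)) (zeroʳ (u i)))) (sum-replicate-zero n)

  ·-*ˡ : ∀ {n} a (u v : Fin n → Carrier) → (λ i → a * u i) · v ≈ a * (u · v)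
  ·-*ˡ a u v = trans (sum-cong-≋ (λ i → *-assoc a (u i) (v i))) (sym (*-distribˡ-sum a (λ i → u i * v i)))

  ·-*ʳ : ∀ {n} a (u v : Fin n → Carrier) → u · (λ i → a * v i) ≈ a * (u · v)
  ·-*ʳ a u v = trans (sum-cong-≋ (λ i → x∙yz≈y∙xz (u i) a (v i))) (sym (*-distribˡ-sum a (λ i → u i * v i)))

  basis : ∀ {n} → Fin n → Fin n → Carrier
  basis zero    zero    = 1#
  basis zero    (suc _) = 0#
  basis (suc _) zero    = 0#
  basis (suc t) (suc s) = basis t s

  ·-basis : ∀ {n} (u : Fin n → Carrier) t → u · basis t ≈ u t
  ·-basis {ℕ.suc n} u zero =
    trans (+-cong (*-identityʳ (u zero)) (·-zeroʳ (u ∘ suc) (λ _ → 0#) (λ _ → refl)))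
          (+-identityʳ (u zero))
  ·-basis {ℕ.suc n} u (suc t) =
    trans (+-cong (zeroʳ (u zero)) (·-basis (u ∘ suc) t)) (+-identityˡ (u (suc t)))

  ·-basis-combination : ∀ {n} (u : Fin n → Carrier) t k a →
                        u · (λ s → basis t s + a * basis k s) ≈ u t + a * u k
  ·-basis-combination u t k a = begin
    u · (λ s → basis t s + a * basis k s)
      ≈⟨ sum-cong-≋ (λ s → distribˡ (u s) _ _) ⟩
    sum (λ s → u s * basis t s + u s * (a * basis k s))
      ≈⟨ ∑-distrib-+ (λ s → u s * basis t s) (λ s → u s * (a * basis k s)) ⟩
    u · basis t + u · (λ s → a * basis k s)
      ≈⟨ +-cong (·-basis u t) (trans (·-*ʳ a u (basis k)) (*-congˡ (·-basis u k))) ⟩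
    u t + a * u k ∎

module _ {c ℓ} (F : CommutativeRing c ℓ) (isField : IsField F) {q} (card : HasCardinality F q) where
  open CommutativeRing F hiding (zero)
  open DotProduct F
  open import Algebra.Properties.Ring ring using (-‿distribˡ-*)
  open import Algebra.Properties.Group +-group using (x∙y⁻¹≈ε⇒x≈y; x≈y⇒x∙y⁻¹≈ε)
  open import Relation.Binary.Reasoning.Setoid setoid

  private
    _≟_ : ∀ x y → Dec (x ≈ y)
    _≟_ = HasCardinality⇒≈-dec F card

  annihilator-⊆⇒proportional : ∀ {n} (u u' : Fin n → Carrier) → NonZeroVec F u →
                               (∀ w → u · w ≈ 0# → u' · w ≈ 0#) → ∃[ μ ] (∀ t → u' t ≈ μ * u t)
  annihilator-⊆⇒proportional {n} u u' u≢0 annihilator-⊆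
    with ¬∀⟶∃¬ n (λ t → u t ≈ 0#) (λ t → u t ≟ 0#) u≢0
  ... | k , uₖ≉0 with proj₂ isField (u k) uₖ≉0
  ...   | b , uₖb≈1 = b * u' k , proportional
    where
    -- w t = e_t - (u_t / u_k) e_k annihilates u, and pairing it with u' isolates u'_t.
    w : Fin n → Fin n → Carrier
    w t s = basis t s + (- (u t * b)) * basis k s

    ·-w : ∀ v t → v · w t ≈ v t - (u t * b) * v k
    ·-w v t = trans (·-basis-combination v t k _) (+-congˡ (sym (-‿distribˡ-* (u t * b) (v k))))

    u·w≈0 : ∀ t → u · w t ≈ 0#
    u·w≈0 t = trans (·-w u t) (x≈y⇒x∙y⁻¹≈ε (sym (begin
      (u t * b) * u k ≈⟨ *-assoc (u t) b (u k) ⟩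
      u t * (b * u k) ≈⟨ *-congˡ (trans (*-comm b (u k)) uₖb≈1) ⟩
      u t * 1#        ≈⟨ *-identityʳ (u t) ⟩
      u t             ∎)))

    proportional : ∀ t → u' t ≈ (b * u' k) * u t
    proportional t = begin
      u' t             ≈⟨ x∙y⁻¹≈ε⇒x≈y _ _ (trans (sym (·-w u' t)) (annihilator-⊆ (w t) (u·w≈0 t))) ⟩
      (u t * b) * u' k ≈⟨ *-assoc (u t) b (u' k) ⟩
      u t * (b * u' k) ≈⟨ *-comm (u t) (b * u' k) ⟩
      (b * u' k) * u t ∎

  columns-cover⇒annihilator-⊆ : ∀ {h M} (G : Fin h → Fin M → Carrier) →
    (∀ w → NonZeroVec F w → ∃[ j ] ∃[ μ ] (∀ i → w i ≈ μ * G i j)) →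
    ∀ (u u' : Fin h → Carrier) → (∀ j → u · column G j ≈ 0# → u' · column G j ≈ 0#) →
    ∀ w → u · w ≈ 0# → u' · w ≈ 0#
  columns-cover⇒annihilator-⊆ G covers u u' columns-⊆ w u·w≈0 =
    decidable-stable ((u' · w) ≟ 0#) refute
    where
    refute : ¬ ¬ (u' · w ≈ 0#)
    refute u'·w≉0 with covers w (λ w≈0 → u'·w≉0 (·-zeroʳ u' w w≈0))
    ... | j , μ , w≈μGⱼ = u'·w≉0 (trans (·-w≈μ·Gⱼ u') (trans (*-congˡ (columns-⊆ j u·Gⱼ≈0)) (zeroʳ μ)))
      where
      ·-w≈μ·Gⱼ : ∀ v → v · w ≈ μ * (v · column G j)
      ·-w≈μ·Gⱼ v = trans (·-congʳ v w≈μGⱼ) (·-*ʳ μ v (column G j))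

      μ≉0 : ¬ (μ ≈ 0#)
      μ≉0 μ≈0 = u'·w≉0 (trans (·-w≈μ·Gⱼ u') (trans (*-congʳ μ≈0) (zeroˡ _)))

      u·Gⱼ≈0 : u · column G j ≈ 0#
      u·Gⱼ≈0 = IsField⇒x*y≈0⇒y≈0 F isField μ≉0 (trans (sym (·-w≈μ·Gⱼ u)) u·w≈0)

module OuterMinimality
  {c ℓ c' ℓ'} (F : CommutativeRing c ℓ) (isField : IsField F) {q} (card : HasCardinality F q)
  (L : CommutativeRing c' ℓ') (ι : CommutativeRing.Carrier F → CommutativeRing.Carrier L)
  {h M} (G : Fin h → Fin M → CommutativeRing.Carrier F)
  (covers : ∀ w → NonZeroVec F w →
              ∃[ j ] ∃[ μ ] (∀ i → CommutativeRing._≈_ F (w i) (CommutativeRing._*_ F μ (G i j))))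
  (π : CommutativeRing.Carrier L → Fin M → CommutativeRing.Carrier F)
  (isSimplexEmbedding : IsSimplexEmbedding F L ι h M G π) where
  private
    module L = CommutativeRing L
  open CommutativeRing F hiding (zero)
  open DotProduct F
  open import Relation.Binary.Reasoning.Setoid setoid

  private
    _≟_ : ∀ x y → Dec (x ≈ y)
    _≟_ = HasCardinality⇒≈-dec F card

    ≈-stable : ∀ {x y} → ¬ ¬ (x ≈ y) → x ≈ y
    ≈-stable = decidable-stable (_ ≟ _)

  π-cong : ∀ {x y} → x L.≈ y → ∀ j → π x j ≈ π y j
  π-cong = proj₁ isSimplexEmbedding _ _

  π-• : ∀ a x j → π (ι a L.* x) j ≈ a * π x j
  π-• = proj₁ (proj₂ (proj₂ isSimplexEmbedding))

  π-injective : ∀ x y → (∀ j → π x j ≈ π y j) → x L.≈ y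
  π-injective = proj₁ (proj₂ (proj₂ (proj₂ isSimplexEmbedding)))

  π-coordinates : ∀ x → ∃[ u ] (∀ j → π x j ≈ u · column G j)
  π-coordinates x
    with Equivalence.to (proj₂ (proj₂ (proj₂ (proj₂ isSimplexEmbedding))) (π x)) (x , λ _ → refl)
  ... | u , πx≈∑uG = u , λ j → trans (πx≈∑uG j) (reflexive (∑≡sum (λ i → u i * G i j)))

  π-zero : ∀ j → π L.0# j ≈ 0#
  π-zero j = begin
    π L.0# j               ≈⟨ π-cong (L.sym (L.zeroʳ (ι 0#))) j ⟩
    π (ι 0# L.* L.0#) j    ≈⟨ π-• 0# L.0# j ⟩
    0# * π L.0# j          ≈⟨ zeroˡ (π L.0# j) ⟩
    0#                     ∎

  π≈0⇒≈0 : ∀ {x} → (∀ j → π x j ≈ 0#) → x L.≈ L.0#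
  π≈0⇒≈0 {x} πx≈0 = π-injective x L.0# (λ j → trans (πx≈0 j) (sym (π-zero j)))

  multiple⇒π-multiple : ∀ {x y} a → y L.≈ ι a L.* x → ∀ j → π y j ≈ a * π x j
  multiple⇒π-multiple {x} a y≈ax j = trans (π-cong y≈ax j) (π-• a x j)

  π-multiple⇒multiple : ∀ {x y} a → (∀ j → π y j ≈ a * π x j) → y L.≈ ι a L.* x
  π-multiple⇒multiple {x} {y} a πy≈aπx =
    π-injective y (ι a L.* x) (λ j → trans (πy≈aπx j) (sym (π-• a x j)))

  multiple⇒π-support-⊆ : ∀ {x y} a → y L.≈ ι a L.* x → ∀ j → ¬ (π y j ≈ 0#) → ¬ (π x j ≈ 0#)
  multiple⇒π-support-⊆ a y≈ax j πy≉0 πx≈0 =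
    πy≉0 (trans (multiple⇒π-multiple a y≈ax j) (trans (*-congˡ πx≈0) (zeroʳ a)))

  π-support-⊆⇒multiple : ∀ x y → ¬ (x L.≈ L.0#) → (∀ j → ¬ (π y j ≈ 0#) → ¬ (π x j ≈ 0#)) →
                         ∃[ μ ] (y L.≈ ι μ L.* x)
  π-support-⊆⇒multiple x y x≉0 support-⊆ with π-coordinates x | π-coordinates y
  ... | u , πx≈uG | u' , πy≈u'G =
    map₂ (λ u'≈μu → π-multiple⇒multiple _ (πy≈μπx u'≈μu))
         (annihilator-⊆⇒proportional F isField card u u' u≢0
           (columns-cover⇒annihilator-⊆ F isField card G covers u u' columns-⊆))
    where
    u≢0 : NonZeroVec F u
    u≢0 u≈0 = x≉0 (π≈0⇒≈0 λ j → trans (πx≈uG j) (·-zeroˡ u (column G j) u≈0))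

    columns-⊆ : ∀ j → u · column G j ≈ 0# → u' · column G j ≈ 0#
    columns-⊆ j u·Gⱼ≈0 = ≈-stable λ u'·Gⱼ≉0 →
      support-⊆ j (λ πy≈0 → u'·Gⱼ≉0 (trans (sym (πy≈u'G j)) πy≈0)) (trans (πx≈uG j) u·Gⱼ≈0)

    πy≈μπx : ∀ {μ} → (∀ t → u' t ≈ μ * u t) → ∀ j → π y j ≈ μ * π x j
    πy≈μπx {μ} u'≈μu j = begin
      π y j                        ≈⟨ πy≈u'G j ⟩
      u' · column G j              ≈⟨ ·-congˡ (column G j) u'≈μu ⟩
      (λ i → μ * u i) · column G j ≈⟨ ·-*ˡ μ u (column G j) ⟩
      μ * (u · column G j)         ≈⟨ *-congˡ (πx≈uG j) ⟨
      μ * π x j                    ∎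

  module _ {N p} (C : (Fin N → L.Carrier) → Set p) where

    outerMinimalCode⇒outerMinimalWords : IsOuterMinimalCode F L ι π C →
      ∀ x → C x → NonZeroVec L x → IsOuterMinimalWord F L ι C x
    outerMinimalCode⇒outerMinimalWords minimal x Cx x≢0 x' Cx' σx'⊆σx x'∈𝔽x
      with all? (λ i → all? (λ j → π (x' i) j ≟ 0#))
    ... | yes πx'≈0 = 0# , λ i → π-multiple⇒multiple 0# (λ j →
      trans (πx'≈0 i j) (sym (zeroˡ (π (x i) j))))
    ... | no πx'≢0 = map₂ (λ πx'≈λπx i → π-multiple⇒multiple _ (λ j → πx'≈λπx (i , j)))
      (minimal (concat x) (concat x') (x , Cx , λ _ _ → refl) (x' , Cx' , λ _ _ → refl)
               (λ πx≈0 → x≢0 (λ i → π≈0⇒≈0 (λ j → πx≈0 (i , j))))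
               (λ πx'≈0 → πx'≢0 (λ i j → πx'≈0 (i , j)))
               σπx'⊆σπx)
      where
      concat : (Fin N → L.Carrier) → Fin N × Fin M → Carrier
      concat y (i , j) = π (y i) j

      σπx'⊆σπx : _⊆σ_ F (concat x') (concat x)
      σπx'⊆σπx (i , j) πx'≉0 with x'∈𝔽x i (σx'⊆σx i (λ x'ᵢ≈0 → πx'≉0 (trans (π-cong x'ᵢ≈0 j) (π-zero j))))
      ... | λᵢ , x'ᵢ≈λᵢxᵢ = multiple⇒π-support-⊆ λᵢ x'ᵢ≈λᵢxᵢ j πx'≉0

    outerMinimalWords⇒outerMinimalCode : (∀ x → C x → NonZeroVec L x → IsOuterMinimalWord F L ι C x) →
      IsOuterMinimalCode F L ι π C
    outerMinimalWords⇒outerMinimalCode minimal v v' (x , Cx , v≈πx) (x' , Cx' , v'≈πx') v≢0 _ σv'⊆σv =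
      map₂ (λ x'≈λx (i , j) → trans (v'≈πx' i j)
                                 (trans (multiple⇒π-multiple _ (x'≈λx i) j) (*-congˡ (sym (v≈πx i j)))))
           (minimal x Cx x≢0 x' Cx' σx'⊆σx x'∈𝔽x)
      where
      σπx'⊆σπx : ∀ i j → ¬ (π (x' i) j ≈ 0#) → ¬ (π (x i) j ≈ 0#)
      σπx'⊆σπx i j πx'≉0 πx≈0 =
        σv'⊆σv (i , j) (λ v'≈0 → πx'≉0 (trans (sym (v'≈πx' i j)) v'≈0)) (trans (v≈πx i j) πx≈0)

      x≢0 : NonZeroVec L x
      x≢0 x≈0 = v≢0 (λ (i , j) → trans (v≈πx i j) (trans (π-cong (x≈0 i) j) (π-zero j)))

      σx'⊆σx : _⊆σ_ L x' x
      σx'⊆σx i x'ᵢ≉0 xᵢ≈0 = x'ᵢ≉0 (π≈0⇒≈0 λ j →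
        ≈-stable (λ πx'≉0 → σπx'⊆σπx i j πx'≉0 (trans (π-cong xᵢ≈0 j) (π-zero j))))

      x'∈𝔽x : ∀ i → _∈σ_ L i x → ∃[ λᵢ ] (x' i L.≈ ι λᵢ L.* x i)
      x'∈𝔽x i xᵢ≉0 = π-support-⊆⇒multiple (x i) (x' i) xᵢ≉0 (σπx'⊆σπx i)

-- Of the hypotheses only finiteness of 𝔽_q (which makes its equality decidable, so that
-- supports can be argued about classically), the field axioms of 𝔽_q, the covering
-- property of the simplex generator and the properties of π are needed.
mainTheorem6 : {c ℓ c' ℓ' p : Level} (q h N K : ℕ) →
    IsPrimePower q → 0 < h → 0 < N → 0 < K →
    (F : CommutativeRing c ℓ) → IsField F → HasCardinality F q →
    (L : CommutativeRing c' ℓ') → IsField L →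
    (ι : CommutativeRing.Carrier F → CommutativeRing.Carrier L) →
    IsExtensionOfDegree F L ι h →
    (M : ℕ) (G : Fin h → Fin M → CommutativeRing.Carrier F) → IsSimplexGenerator F L ι h M G →
    (π : CommutativeRing.Carrier L → Fin M → CommutativeRing.Carrier F) →
    IsSimplexEmbedding F L ι h M G π →
    (C : (Fin N → CommutativeRing.Carrier L) → Set p) → IsLinearCode L N K C →
    IsOuterMinimalCode F L ι π C ⇔
      (∀ x → C x → NonZeroVec L x → IsOuterMinimalWord F L ι C x)
mainTheorem6 _ _ _ _ _ _ _ _ F isField card L _ ι _ _ G (_ , covers , _) π isSimplexEmbedding C _ =
  mk⇔ (outerMinimalCode⇒outerMinimalWords C) (outerMinimalWords⇒outerMinimalCode C)
  where open OuterMinimality F isField card L ι G covers π isSimplexEmbedding
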